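{- For $n\ge 5$, $c_2(n,P_2)=0$, where $P_2$ is the $3$-graph with vertex set $\{v_1,\dots,v_5\}$ and edges $\{v_1,v_2,v_3\},\{v_3,v_4,v_5\}$ (the linear $2$-path).
   Context: For a $3$-graph $G$, $\delta_2(G)$ is the minimum over pairs of vertices of the number of edges containing the pair. $G$ has an $F$-covering if every vertex lies in a copy of $F$; $c_2(n,F)$ is the maximum of $\delta_2(G)$ over $n$-vertex $3$-graphs $G$ with no $F$-covering. -}

module Defs where

open import Data.Nat using (ℕ; zero; suc; _+_; _≤_; _<_)
open import Data.Fin using (Fin; toℕ)
open import Data.Fin.Properties using (all?)
open import Data.Bool using (Bool; true; false; _∧_; _∨_; not; if_then_else_)
open import Data.Bool.Properties renaming (_≟_ to _≟ᵇ_)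
open import Data.List using (List; map; allFin)
open import Data.Nat.ListAction using (sum)
open import Data.Product using (Σ; _×_; _,_; ∃; ∃-syntax)
open import Relation.Binary.PropositionalEquality using (_≡_; _≢_; refl)
open import Relation.Nullary using (¬_)
open import Relation.Nullary.Decidable using (toWitness)

import Data.Nat as ℕ

-- A (simple) 3-graph on vertex set Fin n: a Boolean indicator of the
-- edge {a,b,c}, invariant under permuting a,b,c, and false whenever two
-- of a,b,c coincide (so edges are genuine 3-element sets).
record ThreeGraph (n : ℕ) : Set where
  field
    edge     : Fin n → Fin n → Fin n → Bool
    sym₁₂    : ∀ a b c → edge a b c ≡ edge b a c
    sym₂₃    : ∀ a b c → edge a b c ≡ edge a c b
    loopless : ∀ a c → edge a a c ≡ false
open ThreeGraph public

codeg : ∀ {n} → ThreeGraph n → Fin n → Fin n → ℕ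
codeg {n} G x y = sum (map (λ z → if edge G x y z then 1 else 0) (allFin n))

IsMinCodegree : ∀ {n} → ThreeGraph n → ℕ → Set
IsMinCodegree {n} G d =
  (∃[ x ] ∃[ y ] (x ≢ y × codeg G x y ≡ d)) ×
  (∀ x y → x ≢ y → d ≤ codeg G x y)

IsCopy : ∀ {k n} → ThreeGraph k → ThreeGraph n → (Fin k → Fin n) → Set
IsCopy {k} {n} F G φ =
  (∀ {i j} → φ i ≡ φ j → i ≡ j) ×
  (∀ a b c → edge F a b c ≡ true → edge G (φ a) (φ b) (φ c) ≡ true)

HasCovering : ∀ {k n} → ThreeGraph k → ThreeGraph n → Set
HasCovering {k} {n} F G =
  ∀ (v : Fin n) → ∃[ φ ] (IsCopy F G φ × ∃[ i ] φ i ≡ v)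

IsC₂ : ∀ {k} → ℕ → ThreeGraph k → ℕ → Set
IsC₂ n F c =
  (Σ (ThreeGraph n) λ G → ¬ HasCovering F G × IsMinCodegree G c) ×
  (∀ (G : ThreeGraph n) d → ¬ HasCovering F G → IsMinCodegree G d → d ≤ c)

-- The linear 2-path P₂ on {v₁,…,v₅} = Fin 5 (vᵢ ↦ i-1):
-- edges {v₁,v₂,v₃} = {0,1,2} and {v₃,v₄,v₅} = {2,3,4}.
private
  distinct3 : Fin 5 → Fin 5 → Fin 5 → Bool
  distinct3 a b c = not (toℕ a ℕ.≡ᵇ toℕ b) ∧ not (toℕ b ℕ.≡ᵇ toℕ c) ∧ not (toℕ a ℕ.≡ᵇ toℕ c)

  inA : Fin 5 → Bool
  inA a = toℕ a ℕ.<ᵇ 3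

  inB : Fin 5 → Bool
  inB a = 1 ℕ.<ᵇ toℕ a

  p2edge : Fin 5 → Fin 5 → Fin 5 → Bool
  p2edge a b c = distinct3 a b c ∧ ((inA a ∧ inA b ∧ inA c) ∨ (inB a ∧ inB b ∧ inB c))

P₂ : ThreeGraph 5
P₂ = record
  { edge     = p2edge
  ; sym₁₂    = toWitness {a? = all? λ a → all? λ b → all? λ c → p2edge a b c ≟ᵇ p2edge b a c} _
  ; sym₂₃    = toWitness {a? = all? λ a → all? λ b → all? λ c → p2edge a b c ≟ᵇ p2edge a c b} _
  ; loopless = toWitness {a? = all? λ a → all? λ c → p2edge a a c ≟ᵇ false} _
  }

module Submission where

-- The empty 3-graph has no P₂-covering and δ₂ = 0.  Conversely, if every pair has
-- positive codegree, every vertex v lies in a linear 2-path: take an edge {v,p,q},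
-- two further vertices c,d and an edge {c,d,z}.  If z ∈ {v,p,q}, this edge and
-- {v,p,q} meet exactly in z.  Otherwise take an edge {v,c,w}: if w ∉ {p,q} it meets
-- {p,q,v} exactly in v, and if w ∈ {p,q} the edge {v,w,c} meets {c,d,z} exactly in c.

open import Defs
open import Data.Nat using (ℕ; zero; suc; _≥_; _≤_; _<_; z≤n; s≤s)
open import Data.Nat.Properties using (≤-trans; <⇒≤)
open import Data.Fin using (Fin; zero; suc; #_)
open import Data.Fin.Properties using (_≟_; all?; any?; pigeonhole; <⇒≢)
open import Data.Bool using (Bool; true; false; if_then_else_)
open import Data.Bool.Properties using () renaming (_≟_ to _≟ᵇ_)
open import Data.List using (List; []; _∷_; _++_; map; length; lookup; allFin)
open import Data.List.Membership.Propositional using (_∈_)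
open import Data.List.Membership.Propositional.Properties using (∈-lookup; ∈-map⁺; ∈-++⁻)
open import Data.List.Membership.Setoid.Properties using (index-injective)
import Data.List.Membership.DecPropositional as DecMembership
open import Data.List.Relation.Unary.All using (All; []; _∷_)
import Data.List.Relation.Unary.All as All
open import Data.List.Relation.Unary.All.Properties using (¬Any⇒All¬)
open import Data.List.Relation.Unary.Any using (here; there; index)
open import Data.List.Relation.Unary.Any.Properties using (lookup-index)
open import Data.List.Relation.Unary.AllPairs using ([]; _∷_)
open import Data.List.Relation.Unary.Unique.Propositional using (Unique)
open import Data.Nat.ListAction using (sum)
open import Data.Product using (_×_; _,_; ∃-syntax)
open import Data.Product.Properties using (≡-dec)
open import Data.Sum using ([_,_])
open import Data.Empty using (⊥-elim)
open import Function using (_∘_)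
open import Relation.Binary.PropositionalEquality using (_≡_; _≢_; refl; sym; trans; cong; ≢-sym; setoid)
open import Relation.Nullary using (¬_; yes; no; contradiction)
open import Relation.Nullary.Decidable using (toWitness; decidable-stable; _→-dec_)

sum-map-zero : ∀ {A : Set} (xs : List A) → sum (map (λ _ → 0) xs) ≡ 0
sum-map-zero []       = refl
sum-map-zero (_ ∷ xs) = sum-map-zero xs

indicator-sum-pos⇒∃ : ∀ {A : Set} (f : A → Bool) (xs : List A) →
                      0 < sum (map (λ x → if f x then 1 else 0) xs) → ∃[ x ] f x ≡ true
indicator-sum-pos⇒∃ f (x ∷ xs) pos with f x in fx≡true
... | true  = x , fx≡true
... | false = indicator-sum-pos⇒∃ f xs pos

lookup-injective : ∀ {A : Set} {xs : List A} → Unique xs →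
                   ∀ {i j} → lookup xs i ≡ lookup xs j → i ≡ j
lookup-injective (_ ∷ _)         {zero}  {zero}  _  = refl
lookup-injective (x≢xs ∷ _)      {zero}  {suc j} eq = ⊥-elim (All.lookup x≢xs (∈-lookup j) eq)
lookup-injective (x≢xs ∷ _)      {suc i} {zero}  eq = ⊥-elim (All.lookup x≢xs (∈-lookup i) (sym eq))
lookup-injective (_ ∷ xs-unique) {suc i} {suc j} eq = cong suc (lookup-injective xs-unique eq)

short-list-misses : ∀ {n} (xs : List (Fin n)) → length xs < n → ¬ (∀ x → x ∈ xs)
short-list-misses xs |xs|<n covers
  with i , j , i<j , same-index ← pigeonhole |xs|<n (index ∘ covers)
  = <⇒≢ i<j (index-injective (setoid _) (covers i) (covers j) same-index)

fresh : ∀ {n} (xs : List (Fin n)) → length xs < n → ∃[ x ] All (x ≢_) xs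
fresh xs |xs|<n with any? (λ x → DecMembership._∉?_ _≟_ x xs)
... | yes (x , x∉xs) = x , ¬Any⇒All¬ xs x∉xs
... | no no-fresh    = contradiction covers (short-list-misses xs |xs|<n)
  where
  covers : ∀ x → x ∈ xs
  covers x = decidable-stable (DecMembership._∈?_ _≟_ x xs) (no-fresh ∘ (x ,_))

orderings : ∀ {A : Set} → A → A → A → List (A × A × A)
orderings a b c = (a , b , c) ∷ (a , c , b) ∷ (b , a , c) ∷ (b , c , a) ∷ (c , a , b) ∷ (c , b , a) ∷ []

P₂-edge⇒orderings : ∀ x y z → edge P₂ x y z ≡ true →
                    (x , y , z) ∈ orderings (# 0) (# 1) (# 2) ++ orderings (# 2) (# 3) (# 4)
P₂-edge⇒orderings = toWitness {a? = all? λ x → all? λ y → all? λ z →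
  (edge P₂ x y z ≟ᵇ true) →-dec DecMembership._∈?_ (≡-dec _≟_ (≡-dec _≟_ _≟_)) (x , y , z) _} _

module _ {n : ℕ} (G : ThreeGraph n) where

  Edge : Fin n → Fin n → Fin n → Set
  Edge a b c = edge G a b c ≡ true

  module _ {a b c : Fin n} (abc : Edge a b c) where

    swap₁₂ : Edge b a c
    swap₁₂ = trans (sym (sym₁₂ G a b c)) abc

    swap₂₃ : Edge a c b
    swap₂₃ = trans (sym (sym₂₃ G a b c)) abc

    rotate : Edge b c a
    rotate = trans (sym (sym₂₃ G b a c)) swap₁₂

    edge⇒≢₁₂ : a ≢ b
    edge⇒≢₁₂ refl = contradiction (trans (sym abc) (loopless G a c)) λ ()

  edge⇒≢₁₃ : ∀ {a b c} → Edge a b c → a ≢ c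
  edge⇒≢₁₃ = edge⇒≢₁₂ ∘ swap₂₃

  edge⇒≢₂₃ : ∀ {a b c} → Edge a b c → b ≢ c
  edge⇒≢₂₃ = edge⇒≢₁₂ ∘ rotate

  edge-orderings : ∀ {a b c x y z} → Edge a b c → (x , y , z) ∈ orderings a b c → Edge x y z
  edge-orderings abc (here refl)                                         = abc
  edge-orderings abc (there (here refl))                                 = swap₂₃ abc
  edge-orderings abc (there (there (here refl)))                         = swap₁₂ abc
  edge-orderings abc (there (there (there (here refl))))                 = rotate abc
  edge-orderings abc (there (there (there (there (here refl)))))         = rotate (rotate abc)
  edge-orderings abc (there (there (there (there (there (here refl)))))) = swap₂₃ (rotate (rotate abc))

  positive-codegree⇒edge : ∀ {x y} → 0 < codeg G x y → ∃[ z ] Edge x y z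
  positive-codegree⇒edge {x} {y} = indicator-sum-pos⇒∃ (edge G x y) (allFin n)

  InCopyOf : ∀ {k} → ThreeGraph k → Fin n → Set
  InCopyOf F v = ∃[ φ ] (IsCopy F G φ × ∃[ i ] φ i ≡ v)

  linear-path⇒P₂ : ∀ {a b c d e v} → Edge a b c → Edge d e c →
                   d ≢ a → d ≢ b → e ≢ a → e ≢ b →
                   v ∈ a ∷ b ∷ c ∷ d ∷ e ∷ [] → InCopyOf P₂ v
  linear-path⇒P₂ {a} {b} {c} {d} {e} abc dec d≢a d≢b e≢a e≢b v∈path =
    lookup path , (lookup-injective distinct , preserves-edges) , index v∈path , sym (lookup-index v∈path)
    where
    path : List (Fin n)
    path = a ∷ b ∷ c ∷ d ∷ e ∷ []
    cde : Edge c d e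
    cde = rotate (rotate dec)
    distinct : Unique path
    distinct = (edge⇒≢₁₂ abc ∷ edge⇒≢₁₃ abc ∷ ≢-sym d≢a ∷ ≢-sym e≢a ∷ [])
             ∷ (edge⇒≢₂₃ abc ∷ ≢-sym d≢b ∷ ≢-sym e≢b ∷ [])
             ∷ (edge⇒≢₁₂ cde ∷ edge⇒≢₁₃ cde ∷ [])
             ∷ (edge⇒≢₁₂ dec ∷ [])
             ∷ [] ∷ []
    preserves-edges : ∀ x y z → edge P₂ x y z ≡ true → Edge (lookup path x) (lookup path y) (lookup path z)
    preserves-edges x y z xyz =
      [ edge-orderings abc ∘ ∈-map⁺ image , edge-orderings cde ∘ ∈-map⁺ image ]
        (∈-++⁻ (orderings (# 0) (# 1) (# 2)) (P₂-edge⇒orderings x y z xyz))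
      where
      image : Fin 5 × Fin 5 × Fin 5 → Fin n × Fin n × Fin n
      image (x , y , z) = lookup path x , lookup path y , lookup path z

  positive-codegree⇒P₂-covering : n ≥ 5 → (∀ x y → x ≢ y → 0 < codeg G x y) → HasCovering P₂ G
  positive-codegree⇒P₂-covering n≥5 positive v
    with p , p≢v ∷ [] ← fresh (v ∷ []) (≤-trans (s≤s (s≤s z≤n)) n≥5)
    with q , vpq ← positive-codegree⇒edge (positive v p (≢-sym p≢v))
    with c , c≢v ∷ c≢p ∷ c≢q ∷ [] ← fresh (v ∷ p ∷ q ∷ []) (<⇒≤ n≥5)
    with d , d≢c ∷ d≢v ∷ d≢p ∷ d≢q ∷ [] ← fresh (c ∷ v ∷ p ∷ q ∷ []) n≥5
    with z , cdz ← positive-codegree⇒edge (positive c d (≢-sym d≢c))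
    with z ≟ v | z ≟ p | z ≟ q
  ... | yes refl | _        | _        = linear-path⇒P₂ (rotate vpq) cdz c≢p c≢q d≢p d≢q (there (there (here refl)))
  ... | no _     | yes refl | _        = linear-path⇒P₂ (swap₂₃ vpq) cdz c≢v c≢q d≢v d≢q (here refl)
  ... | no _     | no _     | yes refl = linear-path⇒P₂ vpq cdz c≢v c≢p d≢v d≢p (here refl)
  ... | no z≢v   | no z≢p   | no z≢q
    with w , vcw ← positive-codegree⇒edge (positive v c (≢-sym c≢v))
    with w ≟ p | w ≟ q
  ... | yes refl | _        = linear-path⇒P₂ (swap₂₃ vcw) (rotate cdz) d≢v d≢p z≢v z≢p (here refl)
  ... | no _     | yes refl = linear-path⇒P₂ (swap₂₃ vcw) (rotate cdz) d≢v d≢q z≢v z≢q (here refl)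
  ... | no w≢p   | no w≢q   = linear-path⇒P₂ (rotate vpq) (rotate vcw) c≢p c≢q w≢p w≢q (there (there (here refl)))

emptyGraph : ∀ n → ThreeGraph n
emptyGraph n = record
  { edge     = λ _ _ _ → false
  ; sym₁₂    = λ _ _ _ → refl
  ; sym₂₃    = λ _ _ _ → refl
  ; loopless = λ _ _ → refl
  }

emptyGraph-δ₂≡0 : ∀ {n} {x y : Fin n} → x ≢ y → IsMinCodegree (emptyGraph n) 0
emptyGraph-δ₂≡0 {n} {x} {y} x≢y = (x , y , x≢y , sum-map-zero (allFin n)) , λ _ _ _ → z≤n

emptyGraph-uncovered : ∀ {k n} (F : ThreeGraph k) a b c → edge F a b c ≡ true →
                       Fin n → ¬ HasCovering F (emptyGraph n)
emptyGraph-uncovered _ _ _ _ abc v covering with covering v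
... | _ , (_ , preserves-edges) , _ with () ← preserves-edges _ _ _ abc

theorem3 : ∀ (n : ℕ) → n ≥ 5 → IsC₂ n P₂ 0
theorem3 n n≥5@(s≤s (s≤s _)) =
  (emptyGraph n , emptyGraph-uncovered P₂ (# 0) (# 1) (# 2) refl zero , emptyGraph-δ₂≡0 0≢1) , δ₂≡0
  where
  0≢1 : zero ≢ suc zero
  0≢1 ()
  δ₂≡0 : ∀ G d → ¬ HasCovering P₂ G → IsMinCodegree G d → d ≤ 0
  δ₂≡0 G zero    _         _            = z≤n
  δ₂≡0 G (suc d) uncovered (_ , d<codeg) =
    ⊥-elim (uncovered (positive-codegree⇒P₂-covering G n≥5 λ x y x≢y → ≤-trans (s≤s z≤n) (d<codeg x y x≢y)))
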